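{- Let $\Gamma$ be a (directed or undirected) strongly regular graph with parameter set $(n,k,t,\lambda,\mu)$. Let $a$ and $b$ be positive integers with $ab=n$, and suppose there exists a homogeneous partition $\pi=\{C_1,\ldots,C_a\}$ of $V(\Gamma)$ into $a$ cells of size $b$ which is column equitable with quotient matrix $Q=(\lambda+b-k)I+\mu(J-I)$ (here $I$ and $J$ are the $a\times a$ identity and all-ones matrices). Then for every positive integer $j$, the $\pi$-join $\Gamma^j_\pi$ of $\Gamma$ in power $j$ is a directed strongly regular graph with parameter set $$\big((ja+1)n,\; jn+k,\; jb+t,\; jb+\lambda,\; jb+\mu\big).$$
   Context: All graphs are finite, without loops or multiple arcs; an undirected edge is regarded as a pair of opposite arcs. A directed strongly regular graph (DSRG) with parameters $(n,k,t,\lambda,\mu)$ is a digraph on $n$ vertices whose adjacency matrix $A$ (a $0/1$ matrix with zero diagonal) satisfies $AJ=JA=kJ$ and $A^2=tI+\lambda A+\mu(J-I-A)$; equivalently every vertex has in- and outdegree $k$, is incident with $t$ undirected edges, and the number of directed 2-paths from $x$ to $y\neq x$ is $\lambda$ if $x\to y$ is an arc and $\mu$ otherwise. An undirected strongly regular graph with parameters $(n,k,\lambda,\mu)$ is regarded as a DSRG with parameters $(n,k,k,\lambda,\mu)$. A partition $\pi=\{C_1,\dots,C_a\}$ of the vertex set is homogeneous of degree $b$ if every cell has exactly $b$ vertices. It is column equitable with quotient matrix $Q=(q_{i,l})$ if for all $i,l$ and every vertex $v\in C_l$ the number of arcs from vertices of $C_i$ to $v$ equals $q_{i,l}$ (independent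 of the choice of $v\in C_l$). The $\pi$-join of $\Gamma$ in power $j$ (for a homogeneous partition $\pi=\{C_1,\dots,C_a\}$ and positive integer $j$) is the digraph $\Gamma^j_\pi$ with vertex set $V(\Gamma)\times\{0,1,\ldots,ja\}$ and the following arcs: $(u,r)\to(v,r)$ whenever $u\to v$ is an arc of $\Gamma$; and for every vertex $(u,r)$, every $i\in\{1,\ldots,a\}$ and every $m\in\{1,\ldots,j\}$, arcs from $(u,r)$ to all vertices $(v,r')$ with $v\in C_i$ and $r'\equiv r+(i-1)j+m \pmod{ja+1}$. There are no other arcs. -}

module Defs where

open import Data.Nat using (ℕ; zero; suc; _+_; _*_; _≡ᵇ_)
open import Data.Nat.DivMod using (_%_)
open import Data.Bool using (Bool; true; false; _∧_; _∨_; if_then_else_)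
open import Data.Fin using (Fin; zero; suc; toℕ; remQuot) renaming (_≟_ to _≟F_)
open import Data.List using (upTo)
open import Data.Bool.ListAction using (any)
open import Data.Product using (_×_; _,_; proj₁; proj₂)
open import Relation.Nullary using (¬_; does)
open import Relation.Binary.PropositionalEquality using (_≡_)

-- A digraph on vertex set Fin n, given by its 0/1 adjacency matrix
-- (true = arc).  Undirected edges are pairs of opposite arcs.
Digraph : ℕ → Set
Digraph n = Fin n → Fin n → Bool

count : ∀ {n} → (Fin n → Bool) → ℕ
count {zero}  f = 0
count {suc n} f = (if f zero then 1 else 0) + count (λ x → f (suc x))

-- Directed strongly regular graph with parameters (n,k,t,lam,mu):
-- A has zero diagonal, AJ = JA = kJ, and A² = tI + lam A + mu (J - I - A)
-- (written entrywise).
record IsDSRG (n k t lam mu : ℕ) (A : Digraph n) : Set where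
  field
    loopless : ∀ x → A x x ≡ false
    outdeg   : ∀ x → count (λ y → A x y) ≡ k
    indeg    : ∀ y → count (λ x → A x y) ≡ k
    diag     : ∀ x → count (λ z → A x z ∧ A z x) ≡ t
    offdiag  : ∀ x y → ¬ (x ≡ y) →
               count (λ z → A x z ∧ A z y) ≡ (if A x y then lam else mu)

-- A labelled partition {C_1,...,C_a} of Fin n given by a cell map
-- (vertex v lies in cell C_{toℕ (c v) + 1}); homogeneous of degree b.
IsHomogeneous : ∀ {n a} → (Fin n → Fin a) → ℕ → Set
IsHomogeneous {n} {a} c b = ∀ (i : Fin a) → count (λ v → does (c v ≟F i)) ≡ b

arcsFromCell : ∀ {n a} → Digraph n → (Fin n → Fin a) → Fin a → Fin n → ℕ
arcsFromCell A c i v = count (λ u → does (c u ≟F i) ∧ A u v)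

-- Column equitable with quotient matrix Q = (lam + b - k) I + mu (J - I).
-- The diagonal entry lam + b - k is an integer; we state
-- q_{i,i} = lam + b - k as q_{i,i} + k = lam + b to stay in ℕ.
IsColumnEquitableQ : ∀ {n a} → Digraph n → (Fin n → Fin a) →
                     (k lam mu b : ℕ) → Set
IsColumnEquitableQ {n} {a} A c k lam mu b =
  ∀ (i l : Fin a) (v : Fin n) → c v ≡ l →
    ((i ≡ l) → arcsFromCell A c i v + k ≡ lam + b) ×
    (¬ (i ≡ l) → arcsFromCell A c i v ≡ mu)

-- Vertex set V(Γ) × {0,...,ja}, encoded as
-- Fin (suc (j * a) * n) via remQuot (first component = layer r,
-- second = vertex of Γ).  Cell C_i (i = 1..a) corresponds to the label
-- toℕ (c v) = i - 1, and m ranges over 1..j as suc m', m' ∈ upTo j.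
joinArc : ∀ {n a} → Digraph n → (Fin n → Fin a) → (j : ℕ) →
          Fin (suc (j * a)) × Fin n → Fin (suc (j * a)) × Fin n → Bool
joinArc {n} {a} A c j (r , u) (r' , v) =
  (does (r ≟F r') ∧ A u v) ∨
  any (λ m' → ((toℕ r + toℕ (c v) * j + suc m') % suc (j * a)) ≡ᵇ toℕ r')
      (upTo j)

join : ∀ {n a} → Digraph n → (Fin n → Fin a) → (j : ℕ) →
       Digraph (suc (j * a) * n)
join {n} {a} A c j x y = joinArc A c j (remQuot n x) (remQuot n y)

module Submission where

-- The π-join Γʲ_π has vertex set (layers Fin N, N = ja + 1) × V(Γ), and its
-- arc indicator splits as  [r = r'] · A(u,v) + jump(r, c v, r'),  where
-- jump(r,i,r') says that one of the jumps of length i·j + 1, …, i·j + j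
-- (taken modulo N) leads from layer r to layer r'.  The result is one identity valid for all pairs
--     of vertices (two-path-identity), solved separately for the same layer,
--     a jump, and two non-adjacent layers.
-- theorem2 assembles the five axioms.

open import Defs
open import Data.Nat using (ℕ; zero; suc; _+_; _*_; _∸_; _≡ᵇ_; _<_; _>_; s≤s; z≤n; NonZero; _%_)
open import Data.Nat.Properties
open import Data.Nat.DivMod using (%-distribˡ-+; m%n%n≡m%n; [m+n]%n≡m%n; m%n<n; m%n≤n; m<n⇒m%n≡m)
open import Data.Nat.Tactic.RingSolver using (solve-∀)
open import Data.Bool using (Bool; true; false; _∧_; if_then_else_; T)
open import Data.Bool.ListAction using (any)
open import Data.List using (upTo; applyUpTo)
open import Data.Fin using (Fin; zero; suc; toℕ; fromℕ<; remQuot; combine; _↑ˡ_; _↑ʳ_)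
  renaming (_≟_ to _≟F_)
open import Data.Fin.Properties
  using (toℕ<n; toℕ-injective; toℕ-fromℕ<; remQuot-combine; combine-remQuot; splitAt-↑ʳ; toℕ-combine)
open import Data.Product using (_×_; _,_; map₁; uncurry)
open import Data.Empty using (⊥-elim)
open import Data.Bool.Properties using (if-float)
open import Function using (id; _∘_)
open import Relation.Nullary using (¬_; Dec; yes; no; does)
open import Relation.Nullary.Decidable using (dec-true; dec-false)
open import Relation.Binary.PropositionalEquality
open import Algebra.Properties.Semiring.Sum +-*-semiring
open ≡-Reasoning

ind : Bool → ℕ
ind b = if b then 1 else 0

ind-∧ : ∀ b c → ind (b ∧ c) ≡ ind b * ind c
ind-∧ false c = refl
ind-∧ true  c = sym (+-identityʳ (ind c))

ind-injective : ∀ {b c} → ind b ≡ ind c → b ≡ c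
ind-injective {false} {false} _ = refl
ind-injective {true}  {true}  _ = refl

ind-dec : {P Q : Set} → (P → Q) → (Q → P) → (P? : Dec P) (Q? : Dec Q) →
          ind (does P?) ≡ ind (does Q?)
ind-dec P→Q Q→P (yes p) Q? = cong ind (sym (dec-true Q? (P→Q p)))
ind-dec P→Q Q→P (no ¬p) Q? = cong ind (sym (dec-false Q? (¬p ∘ Q→P)))

δ : ∀ {n} → Fin n → Fin n → ℕ
δ x y = ind (does (x ≟F y))

δ-refl : ∀ {n} (x : Fin n) → δ x x ≡ 1
δ-refl x = cong ind (dec-true (x ≟F x) refl)

δ-≢ : ∀ {n} {x y : Fin n} → ¬ x ≡ y → δ x y ≡ 0
δ-≢ {x = x} {y} x≢y = cong ind (dec-false (x ≟F y) x≢y)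

δ-sym : ∀ {n} (x y : Fin n) → δ x y ≡ δ y x
δ-sym x y = ind-dec sym sym (x ≟F y) (y ≟F x)

count≡∑ : ∀ {n} (f : Fin n → Bool) → count f ≡ ∑[ x < n ] ind (f x)
count≡∑ {zero}  f = refl
count≡∑ {suc n} f = cong (ind (f zero) +_) (count≡∑ (f ∘ suc))

∑-const : ∀ n k → ∑[ x < n ] k ≡ n * k
∑-const zero    k = refl
∑-const (suc n) k = cong (k +_) (∑-const n k)

∑∑-distrib-+ : ∀ {m n} (f g : Fin m → Fin n → ℕ) →
  ∑[ x < m ] ∑[ y < n ] (f x y + g x y) ≡ ∑[ x < m ] ∑[ y < n ] f x y + ∑[ x < m ] ∑[ y < n ] g x y
∑∑-distrib-+ f g = trans (sum-cong-≗ (λ x → ∑-distrib-+ (f x) (g x)))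
  (∑-distrib-+ (λ x → sum (f x)) (λ x → sum (g x)))

∑-δ : ∀ {n} (i : Fin n) (f : Fin n → ℕ) → ∑[ x < n ] (δ i x * f x) ≡ f i
∑-δ {suc n} zero    f =
  trans (cong₂ _+_ (+-identityʳ (f zero)) (sum-replicate-zero n)) (+-identityʳ (f zero))
∑-δ {suc n} (suc i) f = ∑-δ i (f ∘ suc)

∑-point : ∀ {N} y → y < N → ∑[ x < N ] ind (y ≡ᵇ toℕ x) ≡ 1
∑-point {suc N} zero    _         = cong suc (sum-replicate-zero N)
∑-point {suc N} (suc y) (s≤s y<N) = ∑-point y y<N

∑-remQuot : ∀ {m} n (g : Fin m × Fin n → ℕ) →
  ∑[ x < m * n ] g (remQuot n x) ≡ ∑[ r < m ] ∑[ v < n ] g (r , v)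
∑-remQuot {zero}  n g = refl
∑-remQuot {suc m} n g = trans (∑-++ n (g ∘ remQuot n))
  (cong₂ _+_ (sum-cong-≗ (λ v → cong g (remQuot-combine zero v)))
             (trans (sum-cong-≗ (λ y → cong g (remQuot-↑ʳ y))) (∑-remQuot n (g ∘ map₁ suc))))
  where
  ∑-++ : ∀ k {l} (h : Fin (k + l) → ℕ) → sum h ≡ ∑[ x < k ] h (x ↑ˡ l) + ∑[ y < l ] h (k ↑ʳ y)
  ∑-++ zero    h = refl
  ∑-++ (suc k) h = trans (cong (h zero +_) (∑-++ k (h ∘ suc))) (sym (+-assoc (h zero) _ _))
  remQuot-↑ʳ : (y : Fin (m * n)) → remQuot {suc m} n (n ↑ʳ y) ≡ map₁ suc (remQuot {m} n y)
  remQuot-↑ʳ y rewrite splitAt-↑ʳ n (m * n) y = refl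

remQuot-injective : ∀ {m} n {x y : Fin (m * n)} → remQuot {m} n x ≡ remQuot n y → x ≡ y
remQuot-injective {m} n {x} {y} eq =
  trans (sym (combine-remQuot {m} n x)) (trans (cong (uncurry combine) eq) (combine-remQuot {m} n y))

∑-blocks : ∀ m n (h : ℕ → ℕ) →
  ∑[ x < m * n ] h (toℕ x) ≡ ∑[ i < m ] ∑[ l < n ] h (n * toℕ i + toℕ l)
∑-blocks m n h = begin
  ∑[ x < m * n ] h (toℕ x)
    ≡⟨ sum-cong-≗ {m * n} (λ x → cong (h ∘ toℕ) (sym (combine-remQuot {m} n x))) ⟩
  ∑[ x < m * n ] h (toℕ (uncurry combine (remQuot {m} n x)))
    ≡⟨ ∑-remQuot {m} n (h ∘ toℕ ∘ uncurry combine) ⟩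
  ∑[ i < m ] ∑[ l < n ] h (toℕ (combine i l))
    ≡⟨ sum-cong-≗ {m} (λ i → sum-cong-≗ {n} (λ l → cong h (toℕ-combine i l))) ⟩
  ∑[ i < m ] ∑[ l < n ] h (n * toℕ i + toℕ l) ∎

any-exclusive : (F : ℕ → Bool) (n : ℕ) (f : ℕ → ℕ) →
  (∀ {m₁ m₂} → m₁ < n → m₂ < n → T (F (f m₁)) → T (F (f m₂)) → m₁ ≡ m₂) →
  ind (any F (applyUpTo f n)) ≡ ∑[ m < n ] ind (F (f (toℕ m)))
any-exclusive F zero    f excl = refl
any-exclusive F (suc n) f excl with F (f 0) in first
... | false = any-exclusive F n (f ∘ suc) (λ l₁ l₂ t₁ t₂ → suc-injective (excl (s≤s l₁) (s≤s l₂) t₁ t₂))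
... | true  = cong suc (sym (trans (sum-cong-≗ {n} later-false) (sum-replicate-zero n)))
  where
  later-false : (m : Fin n) → ind (F (f (suc (toℕ m)))) ≡ 0
  later-false m with F (f (suc (toℕ m))) in this
  ... | false = refl
  ... | true  = ⊥-elim (0≢1+n (excl (s≤s z≤n) (s≤s (toℕ<n m)) (subst T (sym first) _) (subst T (sym this) _)))

module Translation (N : ℕ) {{_ : NonZero N}} where

  %-absorbˡ : ∀ x y → (x % N + y) % N ≡ (x + y) % N
  %-absorbˡ x y = begin
    (x % N + y) % N           ≡⟨ %-distribˡ-+ (x % N) y N ⟩
    (x % N % N + y % N) % N   ≡⟨ cong (λ z → (z + y % N) % N) (m%n%n≡m%n x N) ⟩
    (x % N + y % N) % N       ≡⟨ %-distribˡ-+ x y N ⟨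
    (x + y) % N               ∎

  %-absorbʳ : ∀ x y → (x + y % N) % N ≡ (x + y) % N
  %-absorbʳ x y = begin
    (x + y % N) % N ≡⟨ cong (_% N) (+-comm x (y % N)) ⟩
    (y % N + x) % N ≡⟨ %-absorbˡ y x ⟩
    (y + x) % N     ≡⟨ cong (_% N) (+-comm y x) ⟩
    (x + y) % N     ∎

  shift-cancel : ∀ x {e f} → e + f ≡ N → ((x + e) % N + f) % N ≡ x % N
  shift-cancel x {e} {f} e+f≡N = begin
    ((x + e) % N + f) % N ≡⟨ %-absorbˡ (x + e) f ⟩
    (x + e + f) % N       ≡⟨ cong (_% N) (trans (+-assoc x e f) (cong (x +_) e+f≡N)) ⟩
    (x + N) % N           ≡⟨ [m+n]%n≡m%n x N ⟩
    x % N                 ∎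

  -- The residue of d and its complement: translation by d is undone by d⁻.
  d⁻ : ℕ → ℕ
  d⁻ d = N ∸ d % N

  d+d⁻ : ∀ d → d % N + d⁻ d ≡ N
  d+d⁻ d = m+[n∸m]≡n (m%n≤n d N)

  d⁻+d : ∀ d → d⁻ d + d % N ≡ N
  d⁻+d d = m∸n+n≡m (m%n≤n d N)

  shift-injective : ∀ d {x₁ x₂} → x₁ < N → x₂ < N → (x₁ + d) % N ≡ (x₂ + d) % N → x₁ ≡ x₂
  shift-injective d {x₁} {x₂} x₁<N x₂<N same = begin
    x₁                                ≡⟨ m<n⇒m%n≡m x₁<N ⟨
    x₁ % N                            ≡⟨ shift-cancel x₁ (d+d⁻ d) ⟨
    ((x₁ + d % N) % N + d⁻ d) % N     ≡⟨ cong (λ z → (z + d⁻ d) % N) same′ ⟩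
    ((x₂ + d % N) % N + d⁻ d) % N     ≡⟨ shift-cancel x₂ (d+d⁻ d) ⟩
    x₂ % N                            ≡⟨ m<n⇒m%n≡m x₂<N ⟩
    x₂                                ∎
    where
    same′ : (x₁ + d % N) % N ≡ (x₂ + d % N) % N
    same′ = trans (%-absorbʳ x₁ d) (trans same (sym (%-absorbʳ x₂ d)))

  shift-solution : ∀ d {y} → y < N → ((y + d⁻ d) % N + d) % N ≡ y
  shift-solution d {y} y<N = begin
    ((y + d⁻ d) % N + d) % N      ≡⟨ %-absorbʳ ((y + d⁻ d) % N) d ⟨
    ((y + d⁻ d) % N + d % N) % N  ≡⟨ shift-cancel y (d⁻+d d) ⟩
    y % N                         ≡⟨ m<n⇒m%n≡m y<N ⟩
    y                             ∎

  shift-count : ∀ d {y} → y < N → ∑[ x < N ] ind ((toℕ x + d) % N ≡ᵇ y) ≡ 1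
  shift-count d {y} y<N = begin
    ∑[ x < N ] ind ((toℕ x + d) % N ≡ᵇ y)
      ≡⟨ sum-cong-≗ {N} (λ x → ind-dec (to x) (from x) ((toℕ x + d) % N ≟ y) (x₀ ≟F x)) ⟩
    ∑[ x < N ] δ x₀ x                        ≡⟨ sum-cong-≗ {N} (λ x → sym (*-identityʳ (δ x₀ x))) ⟩
    ∑[ x < N ] (δ x₀ x * 1)                  ≡⟨ ∑-δ x₀ (λ _ → 1) ⟩
    1                                        ∎
    where
    x₀ : Fin N
    x₀ = fromℕ< (m%n<n (y + d⁻ d) N)
    solves : (toℕ x₀ + d) % N ≡ y
    solves = trans (cong (λ z → (z + d) % N) (toℕ-fromℕ< (m%n<n (y + d⁻ d) N))) (shift-solution d y<N)
    to : ∀ x → (toℕ x + d) % N ≡ y → x₀ ≡ x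
    to x hit = toℕ-injective (shift-injective d (toℕ<n x₀) (toℕ<n x) (trans solves (sym hit)))
    from : ∀ x → x₀ ≡ x → (toℕ x + d) % N ≡ y
    from x refl = solves

-- The layers {0,…,ja} of the join and its inter-layer arcs: from layer r,
-- a vertex of cell i is reached by the jumps of length i·j + 1, …, i·j + j.
module Layers (j a : ℕ) where

  N : ℕ
  N = suc (j * a)

  open Translation N

  lands : Fin N → ℕ → Fin N → ℕ
  lands r e r' = ind ((toℕ r + e) % N ≡ᵇ toℕ r')

  Jump : Fin N → Fin a → Fin N → Bool
  Jump r i r' = any (λ m → ((toℕ r + toℕ i * j + suc m) % N) ≡ᵇ toℕ r') (upTo j)

  jump : Fin N → Fin a → Fin N → ℕ
  jump r i r' = ind (Jump r i r')

  jump-length<N : (i : Fin a) {m : ℕ} → m < j → toℕ i * j + suc m < N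
  jump-length<N i {m} m<j = s≤s (≤-trans (+-monoʳ-≤ (toℕ i * j) m<j)   -- i·j + (m+1) ≤ i·j + j
    (≤-trans (≤-reflexive (+-comm (toℕ i * j) j))                     --          = (i+1)·j
    (≤-trans (*-monoˡ-≤ j (toℕ<n i)) (≤-reflexive (*-comm a j)))))    --          ≤ a·j = j·a

  -- Distinct jumps of one cell land on distinct layers, so the indicator
  -- of `Jump` is the number of landing jumps.
  jump≡∑ : ∀ r i r' → jump r i r' ≡ ∑[ m < j ] lands r (toℕ i * j + suc (toℕ m)) r'
  jump≡∑ r i r' = trans (any-exclusive _ j id exclusive)
    (sum-cong-≗ {j} (λ m → cong (λ z → ind (z % N ≡ᵇ toℕ r')) (+-assoc (toℕ r) (toℕ i * j) _)))
    where
    landing : ∀ m → toℕ r + toℕ i * j + suc m ≡ (toℕ i * j + suc m) + toℕ r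
    landing m = trans (+-assoc (toℕ r) _ _) (+-comm (toℕ r) _)
    exclusive : ∀ {m₁ m₂} → m₁ < j → m₂ < j →
      T (((toℕ r + toℕ i * j + suc m₁) % N) ≡ᵇ toℕ r') →
      T (((toℕ r + toℕ i * j + suc m₂) % N) ≡ᵇ toℕ r') → m₁ ≡ m₂
    exclusive {m₁} {m₂} m₁<j m₂<j hit₁ hit₂ = suc-injective (+-cancelˡ-≡ (toℕ i * j) _ _
      (shift-injective (toℕ r) (jump-length<N i m₁<j) (jump-length<N i m₂<j) (begin
        (toℕ i * j + suc m₁ + toℕ r) % N ≡⟨ cong (_% N) (landing m₁) ⟨
        (toℕ r + toℕ i * j + suc m₁) % N ≡⟨ ≡ᵇ⇒≡ _ _ hit₁ ⟩
        toℕ r'                           ≡⟨ ≡ᵇ⇒≡ _ _ hit₂ ⟨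
        (toℕ r + toℕ i * j + suc m₂) % N ≡⟨ cong (_% N) (landing m₂) ⟩
        (toℕ i * j + suc m₂ + toℕ r) % N ∎)))

  no-return : ∀ r i → Jump r i r ≡ false
  no-return r i = ind-injective (trans (jump≡∑ r i r)
    (trans (sum-cong-≗ {j} stays-away) (sum-replicate-zero j)))
    where
    stays-away : (m : Fin j) → lands r (toℕ i * j + suc (toℕ m)) r ≡ 0
    stays-away m = cong ind (dec-false ((toℕ r + e) % N ≟ toℕ r) λ back →
      m+1+n≢0 (toℕ i * j) (shift-injective (toℕ r) (jump-length<N i (toℕ<n m)) (s≤s z≤n) (begin
        (e + toℕ r) % N ≡⟨ cong (_% N) (+-comm e (toℕ r)) ⟩
        (toℕ r + e) % N ≡⟨ back ⟩
        toℕ r           ≡⟨ m<n⇒m%n≡m (toℕ<n r) ⟨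
        toℕ r % N       ∎)))
      where
      e : ℕ
      e = toℕ i * j + suc (toℕ m)

  out-jumps : ∀ r i → ∑[ r' < N ] jump r i r' ≡ j
  out-jumps r i = begin
    ∑[ r' < N ] jump r i r'                                    ≡⟨ sum-cong-≗ {N} (jump≡∑ r i) ⟩
    ∑[ r' < N ] ∑[ m < j ] lands r (toℕ i * j + suc (toℕ m)) r'
      ≡⟨ ∑-comm {N} {j} (λ r' m → lands r (toℕ i * j + suc (toℕ m)) r') ⟩
    ∑[ m < j ] ∑[ r' < N ] lands r (toℕ i * j + suc (toℕ m)) r'
      ≡⟨ sum-cong-≗ {j} (λ m → ∑-point _ (m%n<n (toℕ r + (toℕ i * j + suc (toℕ m))) N)) ⟩
    ∑[ m < j ] 1                                               ≡⟨ ∑-const j 1 ⟩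
    j * 1                                                      ≡⟨ *-identityʳ j ⟩
    j                                                          ∎

  in-jumps : ∀ i r' → ∑[ r < N ] jump r i r' ≡ j
  in-jumps i r' = begin
    ∑[ r < N ] jump r i r'                                    ≡⟨ sum-cong-≗ {N} (λ r → jump≡∑ r i r') ⟩
    ∑[ r < N ] ∑[ m < j ] lands r (toℕ i * j + suc (toℕ m)) r'
      ≡⟨ ∑-comm {N} {j} (λ r m → lands r (toℕ i * j + suc (toℕ m)) r') ⟩
    ∑[ m < j ] ∑[ r < N ] lands r (toℕ i * j + suc (toℕ m)) r'
      ≡⟨ sum-cong-≗ {j} (λ m → shift-count (toℕ i * j + suc (toℕ m)) (toℕ<n r')) ⟩
    ∑[ m < j ] 1                                              ≡⟨ ∑-const j 1 ⟩
    j * 1                                                     ≡⟨ *-identityʳ j ⟩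
    j                                                         ∎

  jumps-partition : ∀ r r' → δ r r' + ∑[ i < a ] jump r i r' ≡ 1
  jumps-partition r r' = begin
    δ r r' + ∑[ i < a ] jump r i r'
      ≡⟨ cong₂ _+_ stay (sum-cong-≗ {a} (λ i → jump≡∑ r i r')) ⟩
    lands r 0 r' + ∑[ i < a ] ∑[ m < j ] lands r (toℕ i * j + suc (toℕ m)) r'
      ≡⟨ cong (lands r 0 r' +_) (sum-cong-≗ {a} (λ i → sum-cong-≗ {j} (λ m →
           cong (λ e → lands r e r') (trans (+-suc _ _) (cong (λ z → suc (z + toℕ m)) (*-comm (toℕ i) j)))))) ⟩
    lands r 0 r' + ∑[ i < a ] ∑[ m < j ] lands r (suc (j * toℕ i + toℕ m)) r'
      ≡⟨ cong (lands r 0 r' +_) (∑-blocks a j (λ e → lands r (suc e) r')) ⟨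
    lands r 0 r' + ∑[ e < a * j ] lands r (suc (toℕ e)) r'
      ≡⟨ cong (λ s → lands r 0 r' + ∑[ e < s ] lands r (suc (toℕ e)) r') (*-comm a j) ⟩
    ∑[ e < N ] lands r (toℕ e) r'
      ≡⟨ sum-cong-≗ {N} (λ e → cong (λ z → ind (z % N ≡ᵇ toℕ r')) (+-comm (toℕ r) (toℕ e))) ⟩
    ∑[ e < N ] ind ((toℕ e + toℕ r) % N ≡ᵇ toℕ r')
      ≡⟨ shift-count (toℕ r) (toℕ<n r') ⟩
    1 ∎
    where
    -- staying in layer r is the jump of length 0
    stay : δ r r' ≡ lands r 0 r'
    stay = ind-dec (λ { refl → trans (cong (_% N) (+-identityʳ (toℕ r))) (m<n⇒m%n≡m (toℕ<n r)) })
                   (λ back → toℕ-injective (trans (sym (m<n⇒m%n≡m (toℕ<n r)))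
                                           (trans (cong (_% N) (sym (+-identityʳ (toℕ r)))) back)))
                   (r ≟F r') ((toℕ r + 0) % N ≟ toℕ r')

module Cells {n a : ℕ} (c : Fin n → Fin a) where

  group-by-cells : (f : Fin a → ℕ) (g : Fin n → ℕ) →
    ∑[ w < n ] (f (c w) * g w) ≡ ∑[ i < a ] (f i * ∑[ w < n ] (δ (c w) i * g w))
  group-by-cells f g = begin
    ∑[ w < n ] (f (c w) * g w)
      ≡⟨ sum-cong-≗ {n} (λ w → cong (_* g w) (∑-δ (c w) f)) ⟨
    ∑[ w < n ] (∑[ i < a ] (δ (c w) i * f i) * g w)
      ≡⟨ sum-cong-≗ {n} (λ w → *-distribʳ-sum (g w) (λ i → δ (c w) i * f i)) ⟩
    ∑[ w < n ] ∑[ i < a ] (δ (c w) i * f i * g w)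
      ≡⟨ ∑-comm {n} {a} (λ w i → δ (c w) i * f i * g w) ⟩
    ∑[ i < a ] ∑[ w < n ] (δ (c w) i * f i * g w)
      ≡⟨ sum-cong-≗ {a} (λ i → trans (sum-cong-≗ {n} (λ w → pull-out (δ (c w) i) (f i) (g w)))
                                     (sym (*-distribˡ-sum (f i) (λ w → δ (c w) i * g w)))) ⟩
    ∑[ i < a ] (f i * ∑[ w < n ] (δ (c w) i * g w)) ∎
    where
    pull-out : ∀ d x y → d * x * y ≡ x * (d * y)
    pull-out = solve-∀

  ∑-homogeneous : ∀ {b} → IsHomogeneous c b → (f : Fin a → ℕ) →
    ∑[ w < n ] f (c w) ≡ b * ∑[ i < a ] f i
  ∑-homogeneous {b} hom f = begin
    ∑[ w < n ] f (c w)                                  ≡⟨ sum-cong-≗ {n} (λ w → *-identityʳ (f (c w))) ⟨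
    ∑[ w < n ] (f (c w) * 1)                            ≡⟨ group-by-cells f (λ _ → 1) ⟩
    ∑[ i < a ] (f i * ∑[ w < n ] (δ (c w) i * 1))       ≡⟨ sum-cong-≗ {a} (λ i → cong (f i *_) (cell-size i)) ⟩
    ∑[ i < a ] (f i * b)                                ≡⟨ *-distribʳ-sum b f ⟨
    ∑[ i < a ] f i * b                                  ≡⟨ *-comm _ b ⟩
    b * ∑[ i < a ] f i                                  ∎
    where
    cell-size : ∀ i → ∑[ w < n ] (δ (c w) i * 1) ≡ b
    cell-size i = trans (sum-cong-≗ {n} (λ w → *-identityʳ (δ (c w) i)))
                        (trans (sym (count≡∑ (λ w → does (c w ≟F i)))) (hom i))

module Join {n a : ℕ} (A : Digraph n) (c : Fin n → Fin a) (j : ℕ) {k t lam mu b : ℕ}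
  (Γ : IsDSRG n k t lam mu A) (hom : IsHomogeneous c b)
  (equitable : IsColumnEquitableQ A c k lam mu b) where

  open Layers j a
  open Cells c
  open IsDSRG Γ

  Vertex : Set
  Vertex = Fin N × Fin n

  α : Fin n → Fin n → ℕ
  α u v = ind (A u v)

  arc : Vertex → Vertex → ℕ
  arc x y = ind (joinArc A c j x y)

  out-Γ : ∀ u → ∑[ w < n ] α u w ≡ k
  out-Γ u = trans (sym (count≡∑ (A u))) (outdeg u)

  in-Γ : ∀ v → ∑[ w < n ] α w v ≡ k
  in-Γ v = trans (sym (count≡∑ (λ w → A w v))) (indeg v)

  paths-Γ : Fin n → Fin n → ℕ
  paths-Γ u v = ∑[ w < n ] (α u w * α w v)

  paths-Γ≡count : ∀ u v → paths-Γ u v ≡ count (λ w → A u w ∧ A w v)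
  paths-Γ≡count u v = sym (trans (count≡∑ (λ w → A u w ∧ A w v)) (sum-cong-≗ {n} (λ w → ind-∧ (A u w) (A w v))))

  arc-split : ∀ r u r' v → arc (r , u) (r' , v) ≡ δ r r' * α u v + jump r (c v) r'
  arc-split r u r' v with r ≟F r'
  ... | no _ = refl
  ... | yes refl rewrite no-return r (c v) with A u v
  ...   | true  = refl
  ...   | false = refl

  arc-same-layer : ∀ r u v → joinArc A c j (r , u) (r , v) ≡ A u v
  arc-same-layer r u v = ind-injective (begin
    arc (r , u) (r , v)                 ≡⟨ arc-split r u r v ⟩
    δ r r * α u v + jump r (c v) r      ≡⟨ cong₂ (λ d p → d * α u v + p) (δ-refl r) (cong ind (no-return r (c v))) ⟩
    1 * α u v + 0                       ≡⟨ trans (+-identityʳ _) (*-identityˡ _) ⟩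
    α u v                               ∎)

  arc-other-layer : ∀ r u r' v → ¬ r ≡ r' → joinArc A c j (r , u) (r' , v) ≡ Jump r (c v) r'
  arc-other-layer r u r' v r≢r' =
    ind-injective (trans (arc-split r u r' v) (cong (λ d → d * α u v + jump r (c v) r') (δ-≢ r≢r')))

  -- out-degree: k steps inside the layer, j jumps per vertex of Γ
  outdeg′ : ∀ x → count (λ y → joinArc A c j x (remQuot n y)) ≡ j * n + k
  outdeg′ (r , u) = begin
    count (λ y → joinArc A c j (r , u) (remQuot n y))
      ≡⟨ count≡∑ (λ y → joinArc A c j (r , u) (remQuot n y)) ⟩
    ∑[ y < N * n ] arc (r , u) (remQuot n y)
      ≡⟨ ∑-remQuot {N} n (arc (r , u)) ⟩
    ∑[ r' < N ] ∑[ v < n ] arc (r , u) (r' , v)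
      ≡⟨ sum-cong-≗ {N} (λ r' → sum-cong-≗ {n} (arc-split r u r')) ⟩
    ∑[ r' < N ] ∑[ v < n ] (δ r r' * α u v + jump r (c v) r')
      ≡⟨ ∑∑-distrib-+ (λ r' v → δ r r' * α u v) (λ r' v → jump r (c v) r') ⟩
    ∑[ r' < N ] ∑[ v < n ] (δ r r' * α u v) + ∑[ r' < N ] ∑[ v < n ] jump r (c v) r'
      ≡⟨ cong₂ _+_ within across ⟩
    k + n * j
      ≡⟨ trans (+-comm k (n * j)) (cong (_+ k) (*-comm n j)) ⟩
    j * n + k ∎
    where
    within : ∑[ r' < N ] ∑[ v < n ] (δ r r' * α u v) ≡ k
    within = trans (sum-cong-≗ {N} (λ r' → sym (*-distribˡ-sum (δ r r') (α u))))
                   (trans (∑-δ r (λ _ → ∑[ v < n ] α u v)) (out-Γ u))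
    across : ∑[ r' < N ] ∑[ v < n ] jump r (c v) r' ≡ n * j
    across = trans (∑-comm {N} {n} (λ r' v → jump r (c v) r'))
                   (trans (sum-cong-≗ {n} (λ v → out-jumps r (c v))) (∑-const n j))

  -- in-degree: k steps inside the layer, j jumps per vertex of Γ
  indeg′ : ∀ y → count (λ x → joinArc A c j (remQuot n x) y) ≡ j * n + k
  indeg′ (r' , v) = begin
    count (λ x → joinArc A c j (remQuot n x) (r' , v))
      ≡⟨ count≡∑ (λ x → joinArc A c j (remQuot n x) (r' , v)) ⟩
    ∑[ x < N * n ] arc (remQuot n x) (r' , v)
      ≡⟨ ∑-remQuot {N} n (λ x → arc x (r' , v)) ⟩
    ∑[ r < N ] ∑[ u < n ] arc (r , u) (r' , v)
      ≡⟨ sum-cong-≗ {N} (λ r → sum-cong-≗ {n} (λ u → arc-split r u r' v)) ⟩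
    ∑[ r < N ] ∑[ u < n ] (δ r r' * α u v + jump r (c v) r')
      ≡⟨ ∑∑-distrib-+ (λ r u → δ r r' * α u v) (λ r u → jump r (c v) r') ⟩
    ∑[ r < N ] ∑[ u < n ] (δ r r' * α u v) + ∑[ r < N ] ∑[ u < n ] jump r (c v) r'
      ≡⟨ cong₂ _+_ within across ⟩
    k + n * j
      ≡⟨ trans (+-comm k (n * j)) (cong (_+ k) (*-comm n j)) ⟩
    j * n + k ∎
    where
    within : ∑[ r < N ] ∑[ u < n ] (δ r r' * α u v) ≡ k
    within = trans (sum-cong-≗ {N} (λ r → trans (sym (*-distribˡ-sum (δ r r') (λ u → α u v)))
                                                (cong (_* ∑[ u < n ] α u v) (δ-sym r r'))))
                   (trans (∑-δ r' (λ _ → ∑[ u < n ] α u v)) (in-Γ v))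
    across : ∑[ r < N ] ∑[ u < n ] jump r (c v) r' ≡ n * j
    across = trans (sum-cong-≗ {N} (λ r → ∑-const n (jump r (c v) r')))
                   (trans (sym (*-distribˡ-sum n (λ r → jump r (c v) r'))) (cong (n *_) (in-jumps (c v) r')))

  arcsFromCell≡∑ : ∀ i v → arcsFromCell A c i v ≡ ∑[ w < n ] (δ (c w) i * α w v)
  arcsFromCell≡∑ i v = trans (count≡∑ (λ w → does (c w ≟F i) ∧ A w v))
                             (sum-cong-≗ {n} (λ w → ind-∧ (does (c w ≟F i)) (A w v)))

  paths : Vertex → Vertex → ℕ
  paths x y = count (λ z → joinArc A c j x (remQuot n z) ∧ joinArc A c j (remQuot n z) y)

  module TwoPaths (r : Fin N) (u : Fin n) (r' : Fin N) (v : Fin n) where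

    p : ℕ
    p = jump r (c v) r'

    ∑₂ : (Fin N → Fin n → ℕ) → ℕ
    ∑₂ F = ∑[ r'' < N ] ∑[ w < n ] F r'' w

    step-step step-jump jump-step jump-jump : Fin N → Fin n → ℕ
    step-step r'' w = δ r r'' * (δ r'' r' * (α u w * α w v))
    step-jump r'' w = δ r r'' * (α u w * jump r'' (c v) r')
    jump-step r'' w = δ r'' r' * (jump r (c w) r'' * α w v)
    jump-jump r'' w = jump r (c w) r'' * jump r'' (c v) r'

    expand : paths (r , u) (r' , v) ≡ ∑₂ step-step + ∑₂ step-jump + ∑₂ jump-step + ∑₂ jump-jump
    expand = begin
      paths (r , u) (r' , v)
        ≡⟨ count≡∑ (λ z → joinArc A c j (r , u) (remQuot n z) ∧ joinArc A c j (remQuot n z) (r' , v)) ⟩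
      ∑[ z < N * n ] ind (joinArc A c j (r , u) (remQuot n z) ∧ joinArc A c j (remQuot n z) (r' , v))
        ≡⟨ sum-cong-≗ {N * n} (λ z → ind-∧ (joinArc A c j (r , u) (remQuot n z)) _) ⟩
      ∑[ z < N * n ] (arc (r , u) (remQuot n z) * arc (remQuot n z) (r' , v))
        ≡⟨ ∑-remQuot {N} n (λ z → arc (r , u) z * arc z (r' , v)) ⟩
      ∑₂ (λ r'' w → arc (r , u) (r'' , w) * arc (r'' , w) (r' , v))
        ≡⟨ sum-cong-≗ {N} (λ r'' → sum-cong-≗ {n} (λ w →
             trans (cong₂ _*_ (arc-split r u r'' w) (arc-split r'' w r' v))
                   (four-terms (δ r r'') (α u w) (jump r (c w) r'') (δ r'' r') (α w v) (jump r'' (c v) r')))) ⟩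
      ∑₂ (λ r'' w → step-step r'' w + step-jump r'' w + jump-step r'' w + jump-jump r'' w)
        ≡⟨ ∑∑-distrib-+ (λ r'' w → step-step r'' w + step-jump r'' w + jump-step r'' w) jump-jump ⟩
      ∑₂ (λ r'' w → step-step r'' w + step-jump r'' w + jump-step r'' w) + ∑₂ jump-jump
        ≡⟨ cong (_+ ∑₂ jump-jump) (∑∑-distrib-+ (λ r'' w → step-step r'' w + step-jump r'' w) jump-step) ⟩
      ∑₂ (λ r'' w → step-step r'' w + step-jump r'' w) + ∑₂ jump-step + ∑₂ jump-jump
        ≡⟨ cong (λ s → s + ∑₂ jump-step + ∑₂ jump-jump) (∑∑-distrib-+ step-step step-jump) ⟩
      ∑₂ step-step + ∑₂ step-jump + ∑₂ jump-step + ∑₂ jump-jump ∎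
      where
      four-terms : ∀ d x q d' x' q' → (d * x + q) * (d' * x' + q') ≡
                   d * (d' * (x * x')) + d * (x * q') + d' * (q * x') + q * q'
      four-terms = solve-∀

    ∑-step-step : ∑₂ step-step ≡ δ r r' * paths-Γ u v
    ∑-step-step = trans
      (sum-cong-≗ {N} (λ r'' → trans (sym (*-distribˡ-sum (δ r r'') (λ w → δ r'' r' * (α u w * α w v))))
                                     (cong (δ r r'' *_) (sym (*-distribˡ-sum (δ r'' r') (λ w → α u w * α w v))))))
      (∑-δ r (λ r'' → δ r'' r' * paths-Γ u v))

    ∑-step-jump : ∑₂ step-jump ≡ k * p
    ∑-step-jump = trans
      (sum-cong-≗ {N} (λ r'' → trans (sym (*-distribˡ-sum (δ r r'') (λ w → α u w * jump r'' (c v) r')))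
        (cong (δ r r'' *_) (trans (sym (*-distribʳ-sum (jump r'' (c v) r') (α u))) (cong (_* jump r'' (c v) r') (out-Γ u))))))
      (∑-δ r (λ r'' → k * jump r'' (c v) r'))

    ∑-jump-step : ∑₂ jump-step ≡ ∑[ w < n ] (jump r (c w) r' * α w v)
    ∑-jump-step = trans (∑-comm {N} {n} jump-step)
      (sum-cong-≗ {n} (λ w → trans (sum-cong-≗ {N} (λ r'' → cong (_* (jump r (c w) r'' * α w v)) (δ-sym r'' r')))
                                   (∑-δ r' (λ r'' → jump r (c w) r'' * α w v))))

    -- two jumps r → r'' → r': the first reaches b vertices of every layer
    -- r'' ≠ r, and from each layer r'' there are j jumps into r'
    ∑-jump-jump : ∑₂ jump-jump + b * p ≡ b * j
    ∑-jump-jump = begin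
      ∑₂ jump-jump + b * p
        ≡⟨ cong₂ _+_ (sum-cong-≗ {N} first-jump) (sym (∑-δ r (λ r'' → b * jump r'' (c v) r'))) ⟩
      ∑[ r'' < N ] (b * ∑[ i < a ] jump r i r'' * jump r'' (c v) r') + ∑[ r'' < N ] (δ r r'' * (b * jump r'' (c v) r'))
        ≡⟨ ∑-distrib-+ (λ r'' → b * ∑[ i < a ] jump r i r'' * jump r'' (c v) r')
                       (λ r'' → δ r r'' * (b * jump r'' (c v) r')) ⟨
      ∑[ r'' < N ] (b * ∑[ i < a ] jump r i r'' * jump r'' (c v) r' + δ r r'' * (b * jump r'' (c v) r'))
        ≡⟨ sum-cong-≗ {N} (λ r'' → trans (regroup b (∑[ i < a ] jump r i r'') (jump r'' (c v) r') (δ r r''))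
                                          (cong (b * jump r'' (c v) r' *_) (jumps-partition r r''))) ⟩
      ∑[ r'' < N ] (b * jump r'' (c v) r' * 1)
        ≡⟨ sum-cong-≗ {N} (λ r'' → *-identityʳ (b * jump r'' (c v) r')) ⟩
      ∑[ r'' < N ] (b * jump r'' (c v) r')
        ≡⟨ *-distribˡ-sum b (λ r'' → jump r'' (c v) r') ⟨
      b * ∑[ r'' < N ] jump r'' (c v) r'
        ≡⟨ cong (b *_) (in-jumps (c v) r') ⟩
      b * j ∎
      where
      first-jump : ∀ r'' → ∑[ w < n ] jump-jump r'' w ≡ b * ∑[ i < a ] jump r i r'' * jump r'' (c v) r'
      first-jump r'' = trans (sym (*-distribʳ-sum (jump r'' (c v) r') (λ w → jump r (c w) r'')))
                             (cong (_* jump r'' (c v) r') (∑-homogeneous hom (λ i → jump r i r'')))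
      regroup : ∀ b s q d → b * s * q + d * (b * q) ≡ b * q * (d + s)
      regroup = solve-∀

    cell-arcs : ∀ i → ∑[ w < n ] (δ (c w) i * α w v) + δ (c v) i * (k + mu) ≡ mu + δ (c v) i * (lam + b)
    cell-arcs i with c v ≟F i | equitable i (c v) v refl
    ... | yes cv≡i | diagonal , _ = begin
      Z + (k + mu + 0)          ≡⟨ shuffle Z k mu ⟩
      Z + k + mu                ≡⟨ cong (λ z → z + k + mu) (arcsFromCell≡∑ i v) ⟨
      arcsFromCell A c i v + k + mu ≡⟨ cong (_+ mu) (diagonal (sym cv≡i)) ⟩
      lam + b + mu              ≡⟨ shuffle′ lam b mu ⟩
      mu + (lam + b + 0)        ∎
      where
      Z : ℕ
      Z = ∑[ w < n ] (δ (c w) i * α w v)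
      shuffle : ∀ z k m → z + (k + m + 0) ≡ z + k + m
      shuffle = solve-∀
      shuffle′ : ∀ l b m → l + b + m ≡ m + (l + b + 0)
      shuffle′ = solve-∀
    ... | no cv≢i | _ , off-diagonal =
      trans (+-identityʳ _) (trans (sym (arcsFromCell≡∑ i v)) (trans (off-diagonal (cv≢i ∘ sym)) (sym (+-identityʳ mu))))

    -- … and their number, computed with the quotient matrix of π (plus the
    -- correction terms needed to stay inside ℕ)
    jump-step-count : ∑₂ jump-step + p * (k + mu) + mu * δ r r' ≡ mu + p * (lam + b)
    jump-step-count = begin
      ∑₂ jump-step + p * (k + mu) + mu * δ r r'
        ≡⟨ cong (λ s → s + p * (k + mu) + mu * δ r r') ∑-jump-step ⟩
      ∑[ w < n ] (jump r (c w) r' * α w v) + p * (k + mu) + mu * δ r r'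
        ≡⟨ cong (_+ mu * δ r r') by-cells ⟩
      ∑[ i < a ] (jump r i r' * mu) + p * (lam + b) + mu * δ r r'
        ≡⟨ cong (λ s → s + p * (lam + b) + mu * δ r r') (*-distribʳ-sum mu (λ i → jump r i r')) ⟨
      ∑[ i < a ] jump r i r' * mu + p * (lam + b) + mu * δ r r'
        ≡⟨ regroup (∑[ i < a ] jump r i r') mu (p * (lam + b)) (δ r r') ⟩
      mu * (δ r r' + ∑[ i < a ] jump r i r') + p * (lam + b)
        ≡⟨ cong (λ s → mu * s + p * (lam + b)) (jumps-partition r r') ⟩
      mu * 1 + p * (lam + b)
        ≡⟨ cong (_+ p * (lam + b)) (*-identityʳ mu) ⟩
      mu + p * (lam + b) ∎
      where
      regroup : ∀ s m x d → s * m + x + m * d ≡ m * (d + s) + x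
      regroup = solve-∀
      by-cells : ∑[ w < n ] (jump r (c w) r' * α w v) + p * (k + mu) ≡ ∑[ i < a ] (jump r i r' * mu) + p * (lam + b)
      by-cells = begin
        ∑[ w < n ] (jump r (c w) r' * α w v) + p * (k + mu)
          ≡⟨ cong₂ _+_ (group-by-cells (λ i → jump r i r') (λ w → α w v))
                       (sym (∑-δ (c v) (λ i → jump r i r' * (k + mu)))) ⟩
        ∑[ i < a ] (jump r i r' * Z i) + ∑[ i < a ] (δ (c v) i * (jump r i r' * (k + mu)))
          ≡⟨ ∑-distrib-+ (λ i → jump r i r' * Z i) (λ i → δ (c v) i * (jump r i r' * (k + mu))) ⟨
        ∑[ i < a ] (jump r i r' * Z i + δ (c v) i * (jump r i r' * (k + mu)))
          ≡⟨ sum-cong-≗ {a} (λ i → trans (factor (jump r i r') (Z i) (δ (c v) i) (k + mu))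
               (trans (cong (jump r i r' *_) (cell-arcs i)) (sym (factor′ (jump r i r') mu (δ (c v) i) (lam + b))))) ⟩
        ∑[ i < a ] (jump r i r' * mu + δ (c v) i * (jump r i r' * (lam + b)))
          ≡⟨ ∑-distrib-+ (λ i → jump r i r' * mu) (λ i → δ (c v) i * (jump r i r' * (lam + b))) ⟩
        ∑[ i < a ] (jump r i r' * mu) + ∑[ i < a ] (δ (c v) i * (jump r i r' * (lam + b)))
          ≡⟨ cong (∑[ i < a ] (jump r i r' * mu) +_) (∑-δ (c v) (λ i → jump r i r' * (lam + b))) ⟩
        ∑[ i < a ] (jump r i r' * mu) + p * (lam + b) ∎
        where
        Z : Fin a → ℕ
        Z i = ∑[ w < n ] (δ (c w) i * α w v)
        factor : ∀ q z d x → q * z + d * (q * x) ≡ q * (z + d * x)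
        factor = solve-∀
        factor′ : ∀ q m d x → q * m + d * (q * x) ≡ q * (m + d * x)
        factor′ = solve-∀

    -- the count of all 2-paths, in a form valid for every pair of vertices
    two-path-identity : paths (r , u) (r' , v) + p * (b + mu) + mu * δ r r'
                        ≡ δ r r' * paths-Γ u v + b * j + (mu + p * (lam + b))
    two-path-identity = begin
      paths (r , u) (r' , v) + p * (b + mu) + mu * δ r r'
        ≡⟨ cong (λ s → s + p * (b + mu) + mu * δ r r') expand ⟩
      ∑₂ step-step + ∑₂ step-jump + ∑₂ jump-step + ∑₂ jump-jump + p * (b + mu) + mu * δ r r'
        ≡⟨ cong₂ (λ x y → x + y + ∑₂ jump-step + ∑₂ jump-jump + p * (b + mu) + mu * δ r r') ∑-step-step ∑-step-jump ⟩
      δ r r' * paths-Γ u v + k * p + ∑₂ jump-step + ∑₂ jump-jump + p * (b + mu) + mu * δ r r'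
        ≡⟨ regroup (δ r r' * paths-Γ u v) k p (∑₂ jump-step) (∑₂ jump-jump) b mu (δ r r') ⟩
      δ r r' * paths-Γ u v + (∑₂ jump-jump + b * p) + (∑₂ jump-step + p * (k + mu) + mu * δ r r')
        ≡⟨ cong₂ (λ x y → δ r r' * paths-Γ u v + x + y) ∑-jump-jump jump-step-count ⟩
      δ r r' * paths-Γ u v + b * j + (mu + p * (lam + b)) ∎
      where
      regroup : ∀ x k p s t b m d → x + k * p + s + t + p * (b + m) + m * d ≡ x + (t + b * p) + (s + p * (k + m) + m * d)
      regroup = solve-∀

  open TwoPaths using (two-path-identity)

  -- Solving the two-path identity in its three situations: the same layer
  -- (δ = 1, no jump), a jump (δ = 0, p = 1), and no arc between different
  -- layers (δ = 0, p = 0).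
  settle-same-layer : ∀ {s x d q} → d ≡ 1 → q ≡ 0 →
    s + q * (b + mu) + mu * d ≡ d * x + b * j + (mu + q * (lam + b)) → s ≡ j * b + x
  settle-same-layer {s} {x} refl refl eq =
    +-cancelʳ-≡ mu s (j * b + x) (trans (lhs s mu b) (trans eq (rhs x b j mu lam)))
    where
    lhs : ∀ s m b → s + m ≡ s + 0 * (b + m) + m * 1
    lhs = solve-∀
    rhs : ∀ x b j m l → 1 * x + b * j + (m + 0 * (l + b)) ≡ j * b + x + m
    rhs = solve-∀

  settle-jump : ∀ {s x d q} → d ≡ 0 → q ≡ 1 →
    s + q * (b + mu) + mu * d ≡ d * x + b * j + (mu + q * (lam + b)) → s ≡ j * b + lam
  settle-jump {s} {x} refl refl eq =
    +-cancelʳ-≡ (b + mu) s (j * b + lam) (trans (lhs s mu b) (trans eq (rhs x b j mu lam)))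
    where
    lhs : ∀ s m b → s + (b + m) ≡ s + 1 * (b + m) + m * 0
    lhs = solve-∀
    rhs : ∀ x b j m l → 0 * x + b * j + (m + 1 * (l + b)) ≡ j * b + l + (b + m)
    rhs = solve-∀

  settle-no-jump : ∀ {s x d q} → d ≡ 0 → q ≡ 0 →
    s + q * (b + mu) + mu * d ≡ d * x + b * j + (mu + q * (lam + b)) → s ≡ j * b + mu
  settle-no-jump {s} {x} refl refl eq = trans (lhs s mu b) (trans eq (rhs x b j mu lam))
    where
    lhs : ∀ s m b → s ≡ s + 0 * (b + m) + m * 0
    lhs = solve-∀
    rhs : ∀ x b j m l → 0 * x + b * j + (m + 0 * (l + b)) ≡ j * b + m
    rhs = solve-∀

  same-layer-paths : ∀ r u v → paths (r , u) (r , v) ≡ j * b + paths-Γ u v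
  same-layer-paths r u v =
    settle-same-layer (δ-refl r) (cong ind (no-return r (c v))) (two-path-identity r u r v)

  other-layer-paths : ∀ r u r' v → ¬ r ≡ r' →
    paths (r , u) (r' , v) ≡ (if Jump r (c v) r' then j * b + lam else j * b + mu)
  other-layer-paths r u r' v r≢r' with Jump r (c v) r' in jumps
  ... | true  = settle-jump    (δ-≢ r≢r') (cong ind jumps) (two-path-identity r u r' v)
  ... | false = settle-no-jump (δ-≢ r≢r') (cong ind jumps) (two-path-identity r u r' v)

  loopless′ : ∀ x → joinArc A c j x x ≡ false
  loopless′ (r , u) = trans (arc-same-layer r u u) (loopless u)

  diag′ : ∀ x → paths x x ≡ j * b + t
  diag′ (r , u) = trans (same-layer-paths r u u) (cong (j * b +_) (trans (paths-Γ≡count u u) (diag u)))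

  offdiag′ : ∀ x y → ¬ x ≡ y → paths x y ≡ (if joinArc A c j x y then j * b + lam else j * b + mu)
  offdiag′ (r , u) (r' , v) x≢y = by-layer (r ≟F r')
    where
    by-layer : Dec (r ≡ r') →
      paths (r , u) (r' , v) ≡ (if joinArc A c j (r , u) (r' , v) then j * b + lam else j * b + mu)
    by-layer (yes refl) = begin
      paths (r , u) (r , v)
        ≡⟨ same-layer-paths r u v ⟩
      j * b + paths-Γ u v
        ≡⟨ cong (j * b +_) (trans (paths-Γ≡count u v) (offdiag u v (x≢y ∘ cong (r ,_)))) ⟩
      j * b + (if A u v then lam else mu)
        ≡⟨ if-float (j * b +_) (A u v) ⟩
      (if A u v then j * b + lam else j * b + mu)
        ≡⟨ cong (λ B → if B then j * b + lam else j * b + mu) (arc-same-layer r u v) ⟨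
      (if joinArc A c j (r , u) (r , v) then j * b + lam else j * b + mu) ∎
    by-layer (no r≢r') = trans (other-layer-paths r u r' v r≢r')
      (cong (λ B → if B then j * b + lam else j * b + mu) (sym (arc-other-layer r u r' v r≢r')))

theorem2 : (n k t lam mu : ℕ) (A : Digraph n) → IsDSRG n k t lam mu A →
    (a b : ℕ) → a > 0 → b > 0 → a * b ≡ n →
    (c : Fin n → Fin a) → IsHomogeneous c b →
    IsColumnEquitableQ A c k lam mu b →
    (j : ℕ) → j > 0 →
    IsDSRG (suc (j * a) * n) (j * n + k) (j * b + t) (j * b + lam) (j * b + mu)
      (join A c j)
theorem2 n k t lam mu A Γ a b _ _ _ c hom equitable j _ = record
  { loopless = λ x → loopless′ (remQuot n x)
  ; outdeg   = λ x → outdeg′ (remQuot n x)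
  ; indeg    = λ y → indeg′ (remQuot n y)
  ; diag     = λ x → diag′ (remQuot n x)
  ; offdiag  = λ x y x≢y → offdiag′ (remQuot n x) (remQuot n y) (x≢y ∘ remQuot-injective {suc (j * a)} n)
  }
  where open Join A c j Γ hom equitable
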